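{- (1) Every formula of $\mathcal L_{\Diamond^+}$ is upward-invariant (hence also convex-invariant and union-invariant). (2) Every formula of $\mathcal L_{\boxplus}$ is downward-invariant (hence also convex-invariant). (3) Every formula of $\mathcal L_{\boxplus\Diamond^+}$ is convex-invariant. (4) Every formula of $\mathcal L_{\Rrightarrow!}$ is union-invariant.
   Context: Fix a set $\mathcal P$ of atoms. Formulas of $\mathcal L_{\Rrightarrow}$: $\varphi ::= p \mid \bot \mid (\varphi\wedge\varphi)\mid(\varphi\to\varphi)\mid(\varphi\veebar\varphi)\mid(\varphi\Rrightarrow\varphi)$, $p\in\mathcal P$, with $\veebar$ inquisitive disjunction; $\neg\varphi:=\varphi\to\bot$, $\top:=\neg\bot$, $\boxplus\varphi:=(\top\Rrightarrow\varphi)$, $\Diamond^+\varphi:=\neg(\varphi\Rrightarrow\bot)$. A declarative is a formula in which every occurrence of $\veebar$ lies within an argument of some occurrence of $\Rrightarrow$. Fragments: $\mathcal L_{\boxplus}$ is generated by $p,\bot,\wedge,\to,\veebar,\boxplus$; $\mathcal L_{\Diamond^+}$ by $p,\bot,\wedge,\to,\veebar,\Diamond^+$; $\mathcal L_{\boxplus\Diamond^+}$ by $p,\bot,\wedge,\to,\veebar,\boxplus,\Diamond^+$; $\mathcal L_{\Rrightarrow!}$ consists of formulas of $\mathcal L_{\Rrightarrow}$ in which every subformula of the form $\varphi\Rrightarrow\psi$ has $\psi$ a declarative. An in-model is $M=\langle W,\Sigma,V\rangle$ with $W$ nonempty, $\Sigma(w)$ a set of nonempty subsets of $W$ for each $w$,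 $V:W\times\mathcal P\to\{0,1\}$. Support at $s\subseteq W$: $M,s\models p$ iff $V(w,p)=1$ for all $w\in s$; $M,s\models\bot$ iff $s=\emptyset$; $\wedge$ conjunctively; $M,s\models\varphi\veebar\psi$ iff $M,s\models\varphi$ or $M,s\models\psi$; $M,s\models\varphi\to\psi$ iff for all $t\subseteq s$, $M,t\models\varphi$ implies $M,t\models\psi$; $M,s\models\varphi\Rrightarrow\psi$ iff for all $w\in s$, $t\in\Sigma(w)$, $M,t\models\varphi$ implies $M,t\models\psi$. Closures of $M$ (same $W,V$): $\Sigma^\uparrow(w)=\{t\neq\emptyset: t\supseteq s\text{ for some }s\in\Sigma(w)\}$; $\Sigma^\downarrow(w)=\{t\neq\emptyset: t\subseteq s\text{ for some }s\in\Sigma(w)\}$; $\Sigma^\updownarrow(w)=\{t\neq\emptyset: s\subseteq t\subseteq s'\text{ for some }s,s'\in\Sigma(w)\}$; $\Sigma^\cup(w)=\{t\neq\emptyset: t=\bigcup S\text{ for some }S\subseteq\Sigma(w)\}$, giving $M^\uparrow,M^\downarrow,M^\updownarrow,M^\cup$. A formula $\varphi$ is upward-invariant (resp. downward-, convex-, union-invariant) if for all in-models $M$ and states $s$, $M,s\models\varphi$ iff $M^\uparrow,s\models\varphi$ (resp. $M^\downarrow$, $M^\updownarrow$, $M^\cup$). -}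

module Defs where

open import Level using (Level; 0ℓ) renaming (suc to lsuc)
open import Data.Bool using (Bool; true)
import Data.Product
open import Data.Product using (Σ; ∃; _×_; _,_)
open import Data.Sum using (_⊎_)
open import Data.Empty using (⊥)
open import Relation.Nullary using (¬_)
open import Relation.Binary.PropositionalEquality using (_≡_)
open import Function.Bundles using (_⇔_)

State : Set → Set₁
State W = W → Set

_⊆ₛ_ : {W : Set} → State W → State W → Set
s ⊆ₛ t = ∀ w → s w → t w

NonEmpty : {W : Set} → State W → Set
NonEmpty {W} s = Σ W (λ w → s w)

data Form (P : Set) : Set where
  atom : P → Form P
  bot  : Form P
  _∧'_ : Form P → Form P → Form P
  _⇒_  : Form P → Form P → Form P
  _⩔_  : Form P → Form P → Form P
  _⇛_  : Form P → Form P → Form P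

module _ {P : Set} where
  ¬' : Form P → Form P
  ¬' φ = φ ⇒ bot

  ⊤' : Form P
  ⊤' = ¬' bot

  ⊞ : Form P → Form P
  ⊞ φ = ⊤' ⇛ φ

  ◇⁺ : Form P → Form P
  ◇⁺ φ = ¬' (φ ⇛ bot)

  data Declarative : Form P → Set where
    d-atom : ∀ p → Declarative (atom p)
    d-bot  : Declarative bot
    d-and  : ∀ {φ ψ} → Declarative φ → Declarative ψ → Declarative (φ ∧' ψ)
    d-imp  : ∀ {φ ψ} → Declarative φ → Declarative ψ → Declarative (φ ⇒ ψ)
    d-arr  : ∀ φ ψ → Declarative (φ ⇛ ψ)

  data L⊞ : Form P → Set where
    atom : ∀ p → L⊞ (atom p)
    bot  : L⊞ bot
    and  : ∀ {φ ψ} → L⊞ φ → L⊞ ψ → L⊞ (φ ∧' ψ)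
    imp  : ∀ {φ ψ} → L⊞ φ → L⊞ ψ → L⊞ (φ ⇒ ψ)
    ior  : ∀ {φ ψ} → L⊞ φ → L⊞ ψ → L⊞ (φ ⩔ ψ)
    box  : ∀ {φ} → L⊞ φ → L⊞ (⊞ φ)

  data L◇ : Form P → Set where
    atom : ∀ p → L◇ (atom p)
    bot  : L◇ bot
    and  : ∀ {φ ψ} → L◇ φ → L◇ ψ → L◇ (φ ∧' ψ)
    imp  : ∀ {φ ψ} → L◇ φ → L◇ ψ → L◇ (φ ⇒ ψ)
    ior  : ∀ {φ ψ} → L◇ φ → L◇ ψ → L◇ (φ ⩔ ψ)
    dia  : ∀ {φ} → L◇ φ → L◇ (◇⁺ φ)

  data L⊞◇ : Form P → Set where
    atom : ∀ p → L⊞◇ (atom p)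
    bot  : L⊞◇ bot
    and  : ∀ {φ ψ} → L⊞◇ φ → L⊞◇ ψ → L⊞◇ (φ ∧' ψ)
    imp  : ∀ {φ ψ} → L⊞◇ φ → L⊞◇ ψ → L⊞◇ (φ ⇒ ψ)
    ior  : ∀ {φ ψ} → L⊞◇ φ → L⊞◇ ψ → L⊞◇ (φ ⩔ ψ)
    box  : ∀ {φ} → L⊞◇ φ → L⊞◇ (⊞ φ)
    dia  : ∀ {φ} → L⊞◇ φ → L⊞◇ (◇⁺ φ)

  data L⇛! : Form P → Set where
    atom : ∀ p → L⇛! (atom p)
    bot  : L⇛! bot
    and  : ∀ {φ ψ} → L⇛! φ → L⇛! ψ → L⇛! (φ ∧' ψ)
    imp  : ∀ {φ ψ} → L⇛! φ → L⇛! ψ → L⇛! (φ ⇒ ψ)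
    ior  : ∀ {φ ψ} → L⇛! φ → L⇛! ψ → L⇛! (φ ⩔ ψ)
    arr  : ∀ {φ ψ} → L⇛! φ → L⇛! ψ → Declarative ψ → L⇛! (φ ⇛ ψ)

-- in-models.  Σ(w) is a predicate on states; its universe level ℓ is a
-- parameter only so that the closures (which quantify over states) can be
-- formed; the theorem quantifies over models with ℓ = 0ℓ.

record InModel (P : Set) (ℓ : Level) : Set (lsuc (lsuc 0ℓ) Level.⊔ lsuc ℓ) where
  field
    W          : Set
    inhabited  : W
    Σm         : W → State W → Set ℓ
    Σ-nonempty : ∀ w t → Σm w t → NonEmpty t
    V          : W → P → Bool
open InModel public

_,_⊨_ : {P : Set} {ℓ : Level} (M : InModel P ℓ) → State (W M) → Form P → Set (lsuc 0ℓ Level.⊔ ℓ)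
M , s ⊨ atom p  = Level.Lift _ (∀ w → s w → V M w p ≡ true)
M , s ⊨ bot     = Level.Lift _ (∀ w → ¬ s w)
M , s ⊨ (φ ∧' ψ) = (M , s ⊨ φ) × (M , s ⊨ ψ)
M , s ⊨ (φ ⩔ ψ) = (M , s ⊨ φ) ⊎ (M , s ⊨ ψ)
M , s ⊨ (φ ⇒ ψ) = ∀ (t : State (W M)) → t ⊆ₛ s → M , t ⊨ φ → M , t ⊨ ψ
M , s ⊨ (φ ⇛ ψ) = ∀ w → s w → ∀ (t : State (W M)) → Σm M w t → M , t ⊨ φ → M , t ⊨ ψ

module _ {P : Set} {ℓ : Level} (M : InModel P ℓ) where
  private
    U = W M
    S = Σm M

  Σ↑ : U → State U → Set (lsuc 0ℓ Level.⊔ ℓ)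
  Σ↑ w t = NonEmpty t × ∃ λ (s : State U) → S w s × s ⊆ₛ t

  Σ↓ : U → State U → Set (lsuc 0ℓ Level.⊔ ℓ)
  Σ↓ w t = NonEmpty t × ∃ λ (s : State U) → S w s × t ⊆ₛ s

  Σ↕ : U → State U → Set (lsuc 0ℓ Level.⊔ ℓ)
  Σ↕ w t = NonEmpty t × ∃ λ (s : State U) → ∃ λ (s' : State U) →
             S w s × S w s' × s ⊆ₛ t × t ⊆ₛ s'

  -- t = ⋃ 𝒮 for some 𝒮 ⊆ Σ(w) (set equality read extensionally)
  Σ∪ : U → State U → Set (lsuc 0ℓ Level.⊔ lsuc ℓ)
  Σ∪ w t = NonEmpty t × ∃ λ (𝒮 : State U → Set ℓ) → (∀ u → 𝒮 u → S w u) ×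
             (∀ x → t x ⇔ (∃ λ (u : State U) → 𝒮 u × u x))

  closure : {ℓ' : Level} → (R : U → State U → Set ℓ') →
            (∀ w t → R w t → NonEmpty t) → InModel P ℓ'
  closure R ne = record { W = U ; inhabited = inhabited M ; Σm = R
                        ; Σ-nonempty = ne ; V = V M }

  _↑ : InModel P (lsuc 0ℓ Level.⊔ ℓ)
  _↑ = closure Σ↑ (λ _ _ r → Data.Product.proj₁ r)

  _↓ : InModel P (lsuc 0ℓ Level.⊔ ℓ)
  _↓ = closure Σ↓ (λ _ _ r → Data.Product.proj₁ r)

  _↕ : InModel P (lsuc 0ℓ Level.⊔ ℓ)
  _↕ = closure Σ↕ (λ _ _ r → Data.Product.proj₁ r)

  _∪ : InModel P (lsuc 0ℓ Level.⊔ lsuc ℓ)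
  _∪ = closure Σ∪ (λ _ _ r → Data.Product.proj₁ r)

UpwardInvariant : {P : Set} → Form P → Set₂
UpwardInvariant {P} φ = ∀ (M : InModel P 0ℓ) (s : State (W M)) → (M , s ⊨ φ) ⇔ ((M ↑) , s ⊨ φ)

DownwardInvariant : {P : Set} → Form P → Set₂
DownwardInvariant {P} φ = ∀ (M : InModel P 0ℓ) (s : State (W M)) → (M , s ⊨ φ) ⇔ ((M ↓) , s ⊨ φ)

ConvexInvariant : {P : Set} → Form P → Set₂
ConvexInvariant {P} φ = ∀ (M : InModel P 0ℓ) (s : State (W M)) → (M , s ⊨ φ) ⇔ ((M ↕) , s ⊨ φ)

UnionInvariant : {P : Set} → Form P → Set₂
UnionInvariant {P} φ = ∀ (M : InModel P 0ℓ) (s : State (W M)) → (M , s ⊨ φ) ⇔ ((M ∪) , s ⊨ φ)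

{-# OPTIONS --safe #-}
-- Changing Σ to a closure Σ' ⊇ Σ can only affect the clauses for ⇛, and the
-- inclusion Σ ⊆ Σ' already makes M' ⊨ φ ⇛ ψ imply M ⊨ φ ⇛ ψ.  For the converse
-- one uses that support is persistent (downward closed):
--   * φ ⇛ ⊥ says that no state of Σ(w) supports φ, which remains true when every
--     new state lies above an old one (upward, convex and union closure);
--   * ⊞ φ says that every state of Σ(w) supports φ, which remains true when every
--     new state lies below an old one (downward and convex closure);
--   * declaratives are union closed, so φ ⇛ ψ with ψ declarative survives adding
--     unions of states of Σ(w).
module Submission where

open import Defs
open import Level using (Level; 0ℓ; _⊔_; lift; lower) renaming (suc to lsuc)
open import Data.Product using (_×_; _,_; proj₁; proj₂; ∃-syntax)
open import Data.Product.Function.NonDependent.Propositional using (_×-⇔_)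
open import Data.Sum using (inj₁; inj₂)
open import Data.Sum.Function.Propositional using (_⊎-⇔_)
open import Data.Empty using (⊥-elim)
open import Function.Base using (id)
open import Function.Bundles using (_⇔_; mk⇔; Equivalence)
open Equivalence using (to; from)

⊆ₛ-refl : {U : Set} {s : State U} → s ⊆ₛ s
⊆ₛ-refl _ = id

Covered : ∀ {U : Set} {a} → State U → (State U → Set a) → Set (lsuc 0ℓ ⊔ a)
Covered t Q = ∀ x → t x → ∃[ u ] Q u × u ⊆ₛ t × u x

Covered-map : ∀ {U : Set} {a b} {t : State U} {Q : State U → Set a} {Q′ : State U → Set b} →
              (∀ u → u ⊆ₛ t → Q u → Q′ u) → Covered t Q → Covered t Q′
Covered-map f cov x tx with cov x tx
... | u , Qu , u⊆t , ux = u , f u u⊆t Qu , u⊆t , ux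

module Support {P : Set} {ℓ : Level} (M : InModel P ℓ) where

  ⊨-persistent : ∀ φ {s t} → s ⊆ₛ t → M , t ⊨ φ → M , s ⊨ φ
  ⊨-persistent (atom p) s⊆t (lift h) = lift λ w sw → h w (s⊆t w sw)
  ⊨-persistent bot      s⊆t (lift h) = lift λ w sw → h w (s⊆t w sw)
  ⊨-persistent (φ ∧' ψ) s⊆t (hφ , hψ) = ⊨-persistent φ s⊆t hφ , ⊨-persistent ψ s⊆t hψ
  ⊨-persistent (φ ⩔ ψ)  s⊆t (inj₁ hφ) = inj₁ (⊨-persistent φ s⊆t hφ)
  ⊨-persistent (φ ⩔ ψ)  s⊆t (inj₂ hψ) = inj₂ (⊨-persistent ψ s⊆t hψ)
  ⊨-persistent (φ ⇒ ψ)  s⊆t h u u⊆s = h u λ w uw → s⊆t w (u⊆s w uw)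
  ⊨-persistent (φ ⇛ ψ)  s⊆t h w sw = h w (s⊆t w sw)

  declarative-local : ∀ {ψ t} → Declarative ψ → Covered t (λ u → M , u ⊨ ψ) → M , t ⊨ ψ
  declarative-local (d-atom p) cov = lift λ x tx → let (u , lift uψ , _ , ux) = cov x tx in uψ x ux
  declarative-local d-bot      cov = lift λ x tx → let (u , lift uψ , _ , ux) = cov x tx in uψ x ux
  declarative-local (d-and dφ dψ) cov =
    declarative-local dφ (Covered-map (λ _ _ → proj₁) cov) ,
    declarative-local dψ (Covered-map (λ _ _ → proj₂) cov)
  declarative-local (d-imp {φ} {ψ} dφ dψ) cov t′ t′⊆t t′φ = declarative-local dψ cov′
    where
    cov′ : Covered t′ (λ u → M , u ⊨ ψ)
    cov′ x t′x with cov x (t′⊆t x t′x)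
    ... | u , uφ⇒ψ , _ , ux =
      (λ y → u y × t′ y) , uφ⇒ψ _ (λ _ → proj₁) (⊨-persistent φ (λ _ → proj₂) t′φ) ,
      (λ _ → proj₂) , (ux , t′x)
  declarative-local (d-arr φ ψ) cov w tw = let (u , uφ⇛ψ , _ , uw) = cov w tw in uφ⇛ψ w uw

module _ {P : Set} {ℓ ℓ′ : Level} (M : InModel P ℓ) (R : W M → State (W M) → Set ℓ′) where

  ExtendsΣ : Set (lsuc 0ℓ ⊔ ℓ ⊔ ℓ′)
  ExtendsΣ = ∀ w t → Σm M w t → R w t

  AboveΣ : Set (lsuc 0ℓ ⊔ ℓ ⊔ ℓ′)
  AboveΣ = ∀ w t → R w t → ∃[ u ] Σm M w u × u ⊆ₛ t

  BelowΣ : Set (lsuc 0ℓ ⊔ ℓ ⊔ ℓ′)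
  BelowΣ = ∀ w t → R w t → ∃[ u ] Σm M w u × t ⊆ₛ u

  CoveredByΣ : Set (lsuc 0ℓ ⊔ ℓ ⊔ ℓ′)
  CoveredByΣ = ∀ w t → R w t → Covered t (Σm M w)

  CoveredByΣ⇒AboveΣ : (∀ w t → R w t → NonEmpty t) → CoveredByΣ → AboveΣ
  CoveredByΣ⇒AboveΣ R-nonempty cov w t tR =
    let (x , tx) = R-nonempty w t tR ; (u , uΣ , u⊆t , _) = cov w t tR x tx in u , uΣ , u⊆t

module Invariance {P : Set} {ℓ ℓ′ : Level} (M : InModel P ℓ)
                  (R : W M → State (W M) → Set ℓ′) (R-nonempty : ∀ w t → R w t → NonEmpty t) where

  open Support M

  private
    N : InModel P ℓ′
    N = closure M R R-nonempty

  Invariant : Form P → Set (lsuc 0ℓ ⊔ ℓ ⊔ ℓ′)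
  Invariant φ = ∀ s → (M , s ⊨ φ) ⇔ (N , s ⊨ φ)

  atom-invariant : ∀ p → Invariant (atom p)
  atom-invariant p s = mk⇔ (λ h → lift (lower h)) (λ h → lift (lower h))

  bot-invariant : Invariant bot
  bot-invariant s = mk⇔ (λ h → lift (lower h)) (λ h → lift (lower h))

  ∧-invariant : ∀ {φ ψ} → Invariant φ → Invariant ψ → Invariant (φ ∧' ψ)
  ∧-invariant φ≈ ψ≈ s = φ≈ s ×-⇔ ψ≈ s

  ⩔-invariant : ∀ {φ ψ} → Invariant φ → Invariant ψ → Invariant (φ ⩔ ψ)
  ⩔-invariant φ≈ ψ≈ s = φ≈ s ⊎-⇔ ψ≈ s

  ⇒-invariant : ∀ {φ ψ} → Invariant φ → Invariant ψ → Invariant (φ ⇒ ψ)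
  ⇒-invariant φ≈ ψ≈ s = mk⇔
    (λ h t t⊆s tφ → to   (ψ≈ t) (h t t⊆s (from (φ≈ t) tφ)))
    (λ h t t⊆s tφ → from (ψ≈ t) (h t t⊆s (to   (φ≈ t) tφ)))

  ⊤-invariant : Invariant ⊤'
  ⊤-invariant = ⇒-invariant {bot} {bot} bot-invariant bot-invariant

  ⇛-reflect : ∀ {φ ψ} → ExtendsΣ M R → Invariant φ → Invariant ψ →
              ∀ s → N , s ⊨ (φ ⇛ ψ) → M , s ⊨ (φ ⇛ ψ)
  ⇛-reflect ext φ≈ ψ≈ s h w sw t tΣ tφ = from (ψ≈ t) (h w sw t (ext w t tΣ) (to (φ≈ t) tφ))

  ⇛⊥-preserve : ∀ {φ} → AboveΣ M R → Invariant φ →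
                ∀ s → M , s ⊨ (φ ⇛ bot) → N , s ⊨ (φ ⇛ bot)
  ⇛⊥-preserve {φ} above φ≈ s h w sw t tR tφ =
    let (u , uΣ , u⊆t) = above w t tR ; (x , ux) = Σ-nonempty M w u uΣ in
    ⊥-elim (lower (h w sw u uΣ (⊨-persistent φ u⊆t (from (φ≈ t) tφ))) x ux)

  ⊞-preserve : ∀ {φ} → BelowΣ M R → Invariant φ → ∀ s → M , s ⊨ (⊞ φ) → N , s ⊨ (⊞ φ)
  ⊞-preserve {φ} below φ≈ s h w sw t tR _ =
    let (u , uΣ , t⊆u) = below w t tR in
    to (φ≈ t) (⊨-persistent φ t⊆u (h w sw u uΣ (λ _ _ → id)))

  ⇛-declarative-preserve : ∀ {φ ψ} → CoveredByΣ M R → Invariant φ → Invariant ψ → Declarative ψ →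
                           ∀ s → M , s ⊨ (φ ⇛ ψ) → N , s ⊨ (φ ⇛ ψ)
  ⇛-declarative-preserve {φ} cov φ≈ ψ≈ dψ s h w sw t tR tφ =
    to (ψ≈ t) (declarative-local dψ (Covered-map
      (λ u u⊆t uΣ → h w sw u uΣ (⊨-persistent φ u⊆t (from (φ≈ t) tφ)))
      (cov w t tR)))

  ◇⁺-invariant : ∀ {φ} → ExtendsΣ M R → AboveΣ M R → Invariant φ → Invariant (◇⁺ φ)
  ◇⁺-invariant {φ} ext above φ≈ = ⇒-invariant {φ ⇛ bot} {bot} φ⇛⊥≈ bot-invariant
    where
    φ⇛⊥≈ : Invariant (φ ⇛ bot)
    φ⇛⊥≈ s = mk⇔ (⇛⊥-preserve {φ} above φ≈ s) (⇛-reflect {ψ = bot} ext φ≈ bot-invariant s)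

  ⊞-invariant : ∀ {φ} → ExtendsΣ M R → BelowΣ M R → Invariant φ → Invariant (⊞ φ)
  ⊞-invariant {φ} ext below φ≈ s =
    mk⇔ (⊞-preserve {φ} below φ≈ s) (⇛-reflect {⊤'} ext ⊤-invariant φ≈ s)

  ⇛-declarative-invariant : ∀ {φ ψ} → ExtendsΣ M R → CoveredByΣ M R →
                            Invariant φ → Invariant ψ → Declarative ψ → Invariant (φ ⇛ ψ)
  ⇛-declarative-invariant {φ} {ψ} ext cov φ≈ ψ≈ dψ s =
    mk⇔ (⇛-declarative-preserve {φ} {ψ} cov φ≈ ψ≈ dψ s) (⇛-reflect {φ} {ψ} ext φ≈ ψ≈ s)

  L◇-invariant : ExtendsΣ M R → AboveΣ M R → ∀ {φ} → L◇ φ → Invariant φ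
  L◇-invariant ext above = go
    where
    go : ∀ {φ} → L◇ φ → Invariant φ
    go (atom p)  = atom-invariant p
    go bot       = bot-invariant
    go (and l k) = ∧-invariant (go l) (go k)
    go (imp l k) = ⇒-invariant (go l) (go k)
    go (ior l k) = ⩔-invariant (go l) (go k)
    go (dia l)   = ◇⁺-invariant ext above (go l)

  L⊞-invariant : ExtendsΣ M R → BelowΣ M R → ∀ {φ} → L⊞ φ → Invariant φ
  L⊞-invariant ext below = go
    where
    go : ∀ {φ} → L⊞ φ → Invariant φ
    go (atom p)  = atom-invariant p
    go bot       = bot-invariant
    go (and l k) = ∧-invariant (go l) (go k)
    go (imp l k) = ⇒-invariant (go l) (go k)
    go (ior l k) = ⩔-invariant (go l) (go k)
    go (box l)   = ⊞-invariant ext below (go l)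

  L⊞◇-invariant : ExtendsΣ M R → BelowΣ M R → AboveΣ M R → ∀ {φ} → L⊞◇ φ → Invariant φ
  L⊞◇-invariant ext below above = go
    where
    go : ∀ {φ} → L⊞◇ φ → Invariant φ
    go (atom p)  = atom-invariant p
    go bot       = bot-invariant
    go (and l k) = ∧-invariant (go l) (go k)
    go (imp l k) = ⇒-invariant (go l) (go k)
    go (ior l k) = ⩔-invariant (go l) (go k)
    go (box l)   = ⊞-invariant ext below (go l)
    go (dia l)   = ◇⁺-invariant ext above (go l)

  L⇛!-invariant : ExtendsΣ M R → CoveredByΣ M R → ∀ {φ} → L⇛! φ → Invariant φ
  L⇛!-invariant ext cov = go
    where
    go : ∀ {φ} → L⇛! φ → Invariant φ
    go (atom p)     = atom-invariant p
    go bot          = bot-invariant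
    go (and l k)    = ∧-invariant (go l) (go k)
    go (imp l k)    = ⇒-invariant (go l) (go k)
    go (ior l k)    = ⩔-invariant (go l) (go k)
    go (arr l k dψ) = ⇛-declarative-invariant ext cov (go l) (go k) dψ

module _ {P : Set} {ℓ : Level} (M : InModel P ℓ) where

  Σ↑-extends : ExtendsΣ M (Σ↑ M)
  Σ↑-extends w t tΣ = Σ-nonempty M w t tΣ , t , tΣ , ⊆ₛ-refl

  Σ↑-above : AboveΣ M (Σ↑ M)
  Σ↑-above w t = proj₂

  Σ↓-extends : ExtendsΣ M (Σ↓ M)
  Σ↓-extends w t tΣ = Σ-nonempty M w t tΣ , t , tΣ , ⊆ₛ-refl

  Σ↓-below : BelowΣ M (Σ↓ M)
  Σ↓-below w t = proj₂

  Σ↕-extends : ExtendsΣ M (Σ↕ M)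
  Σ↕-extends w t tΣ = Σ-nonempty M w t tΣ , t , t , tΣ , tΣ , ⊆ₛ-refl , ⊆ₛ-refl

  Σ↕-above : AboveΣ M (Σ↕ M)
  Σ↕-above w t (_ , u , _ , uΣ , _ , u⊆t , _) = u , uΣ , u⊆t

  Σ↕-below : BelowΣ M (Σ↕ M)
  Σ↕-below w t (_ , _ , u′ , _ , u′Σ , _ , t⊆u′) = u′ , u′Σ , t⊆u′

  -- The singleton family {t} lives in Set₁, possibly above the level ℓ of Σ∪'s
  -- families; the states of Σ(w) below t also have union t.
  Σ∪-extends : ExtendsΣ M (Σ∪ M)
  Σ∪-extends w t tΣ =
    Σ-nonempty M w t tΣ , (λ u → Σm M w u × u ⊆ₛ t) , (λ _ → proj₁) ,
    λ x → mk⇔ (λ tx → t , (tΣ , ⊆ₛ-refl) , tx) (λ (u , (_ , u⊆t) , ux) → u⊆t x ux)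

  Σ∪-covered : CoveredByΣ M (Σ∪ M)
  Σ∪-covered w t (_ , 𝒮 , 𝒮⊆Σ , t≈⋃𝒮) x tx =
    let (u , 𝒮u , ux) = to (t≈⋃𝒮 x) tx in
    u , 𝒮⊆Σ u 𝒮u , (λ y uy → from (t≈⋃𝒮 y) (u , 𝒮u , uy)) , ux

  Σ∪-above : AboveΣ M (Σ∪ M)
  Σ∪-above = CoveredByΣ⇒AboveΣ M (Σ∪ M) (λ _ _ → proj₁) Σ∪-covered

module Upward   {P : Set} {ℓ : Level} (M : InModel P ℓ) = Invariance M (Σ↑ M) (λ _ _ → proj₁)
module Downward {P : Set} {ℓ : Level} (M : InModel P ℓ) = Invariance M (Σ↓ M) (λ _ _ → proj₁)
module Convex   {P : Set} {ℓ : Level} (M : InModel P ℓ) = Invariance M (Σ↕ M) (λ _ _ → proj₁)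
module Union    {P : Set} {ℓ : Level} (M : InModel P ℓ) = Invariance M (Σ∪ M) (λ _ _ → proj₁)

proposition4p3 : (P : Set) →
    (∀ (φ : Form P) → L◇ φ → UpwardInvariant φ × ConvexInvariant φ × UnionInvariant φ)
    × (∀ (φ : Form P) → L⊞ φ → DownwardInvariant φ × ConvexInvariant φ)
    × (∀ (φ : Form P) → L⊞◇ φ → ConvexInvariant φ)
    × (∀ (φ : Form P) → L⇛! φ → UnionInvariant φ)
proposition4p3 P =
    (λ φ l → (λ M → Upward.L◇-invariant M (Σ↑-extends M) (Σ↑-above M) l)
           , (λ M → Convex.L◇-invariant M (Σ↕-extends M) (Σ↕-above M) l)
           , (λ M → Union.L◇-invariant M (Σ∪-extends M) (Σ∪-above M) l))
  , (λ φ l → (λ M → Downward.L⊞-invariant M (Σ↓-extends M) (Σ↓-below M) l)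
           , (λ M → Convex.L⊞-invariant M (Σ↕-extends M) (Σ↕-below M) l))
  , (λ φ l M → Convex.L⊞◇-invariant M (Σ↕-extends M) (Σ↕-below M) (Σ↕-above M) l)
  , (λ φ l M → Union.L⇛!-invariant M (Σ∪-extends M) (Σ∪-covered M) l)
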